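{- Let $p\ge q\ge1$ be integers, fix a subset $Q\subseteq[p+2..p+q]$, and let $\mathcal C=\{A\subseteq[p+q]:|A|=p,\ A\cap[p+2..p+q]=Q\}$. Put $$\mathcal A=\{A\in\mathcal C:\Sigma(A)\text{ odd}\},\qquad \mathcal A'=\{A\in\mathcal C:\Sigma(A)\text{ even}\},$$ where $\Sigma(A)=\sum_{i\in A}i$. Then the pair $\mathcal A,\mathcal A'$ is balanced.
   Context: $[n]=\{1,\dots,n\}$, $[i..j]=\{i,\dots,j\}$ (empty if $j<i$). For a $p$-element $A\subseteq[p+q]$, a feasible matching for $A$ is a set $M$ of $q$ pairwise disjoint arcs $(i,j)$, $i<j$, in $[p+q]$, each with exactly one end in $A$, such that for any two arcs the intervals $[i..j]$, $[i'..j']$ are disjoint or nested, and every element lying in the interval of some arc is an endpoint of some arc of $M$. $\mathcal M(A)$ is the set of feasible matchings for $A$. Collections $\mathcal A,\mathcal A'$ of $p$-subsets of $[p+q]$ are balanced if for every arc set $M$, $|\{A\in\mathcal A: M\in\mathcal M(A)\}|=|\{A'\in\mathcal A':M\in\mathcal M(A')\}|$. -}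

module Defs where

open import Data.Bool using (Bool; true; false; _∧_; _∨_; not; _xor_; if_then_else_; T)
open import Data.Nat using (ℕ; zero; suc; _+_; _<_; _≤ᵇ_; _<ᵇ_; _≡ᵇ_; _%_)
open import Data.Fin using (Fin; toℕ)
open import Data.List using (List; []; _∷_; _++_; map; allFin)
open import Data.Nat.ListAction using (sum)
open import Data.Bool.ListAction using (all; any)
open import Data.Vec using (Vec; lookup)
open import Data.Fin.Subset using (Subset)
import Data.Vec as V

-- CONVENTION: the ground set [n] = {1,..,n} is represented by Fin n,
-- the element k : Fin n standing for the integer val k = toℕ k + 1.
val : {n : ℕ} → Fin n → ℕ
val k = suc (toℕ k)

∀ᵇ : {n : ℕ} → (Fin n → Bool) → Bool
∀ᵇ {n} f = all f (allFin n)

∃ᵇ : {n : ℕ} → (Fin n → Bool) → Bool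
∃ᵇ {n} f = any f (allFin n)

_≡ᶠ_ : {n : ℕ} → Fin n → Fin n → Bool
i ≡ᶠ j = toℕ i ≡ᵇ toℕ j

_⇔ᵇ_ : Bool → Bool → Bool
a ⇔ᵇ b = not (a xor b)

_⇒ᵇ_ : Bool → Bool → Bool
a ⇒ᵇ b = not a ∨ b

infixr 4 _⇒ᵇ_

_∈ᵇ_ : {n : ℕ} → Fin n → Subset n → Bool
i ∈ᵇ A = lookup A i

allSubsets : (n : ℕ) → List (Subset n)
allSubsets zero = V.[] ∷ []
allSubsets (suc n) = map (true V.∷_) (allSubsets n) ++ map (false V.∷_) (allSubsets n)

countSubsets : {n : ℕ} → (Subset n → Bool) → ℕ
countSubsets {n} P = sum (map (λ A → if P A then 1 else 0) (allSubsets n))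

size : {n : ℕ} → Subset n → ℕ
size {n} A = sum (map (λ i → if i ∈ᵇ A then 1 else 0) (allFin n))

Σ : {n : ℕ} → Subset n → ℕ
Σ {n} A = sum (map (λ i → if i ∈ᵇ A then val i else 0) (allFin n))

-- An arc set on [n]: M i j = true means the arc (val i, val j) belongs to M.
ArcSet : ℕ → Set
ArcSet n = Fin n → Fin n → Bool

IsArcSet : {n : ℕ} → ArcSet n → Set
IsArcSet {n} M = (i j : Fin n) → T (M i j) → toℕ i < toℕ j

arcCount : {n : ℕ} → ArcSet n → ℕ
arcCount {n} M = sum (map (λ i → sum (map (λ j → if M i j then 1 else 0) (allFin n))) (allFin n))

forallTwoArcs : {n : ℕ} → ArcSet n → (Fin n → Fin n → Fin n → Fin n → Bool) → Bool
forallTwoArcs M P =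
  ∀ᵇ λ i → ∀ᵇ λ j → ∀ᵇ λ i' → ∀ᵇ λ j' →
    (M i j ∧ M i' j') ⇒ᵇ P i j i' j'

pairwiseDisjoint : {n : ℕ} → ArcSet n → Bool
pairwiseDisjoint M = forallTwoArcs M λ i j i' j' →
  (i ≡ᶠ i' ∧ j ≡ᶠ j') ∨
  (not (i ≡ᶠ i') ∧ not (i ≡ᶠ j') ∧ not (j ≡ᶠ i') ∧ not (j ≡ᶠ j'))

disjointOrNested : {n : ℕ} → ArcSet n → Bool
disjointOrNested M = forallTwoArcs M λ i j i' j' →
  (toℕ j <ᵇ toℕ i') ∨ (toℕ j' <ᵇ toℕ i) ∨
  ((toℕ i ≤ᵇ toℕ i') ∧ (toℕ j' ≤ᵇ toℕ j)) ∨
  ((toℕ i' ≤ᵇ toℕ i) ∧ (toℕ j ≤ᵇ toℕ j'))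

oneEndIn : {n : ℕ} → Subset n → ArcSet n → Bool
oneEndIn A M = ∀ᵇ λ i → ∀ᵇ λ j → M i j ⇒ᵇ ((i ∈ᵇ A) xor (j ∈ᵇ A))

covered : {n : ℕ} → ArcSet n → Bool
covered M = ∀ᵇ λ k →
  (∃ᵇ λ i → ∃ᵇ λ j → M i j ∧ (toℕ i ≤ᵇ toℕ k) ∧ (toℕ k ≤ᵇ toℕ j)) ⇒ᵇ
  (∃ᵇ λ i → ∃ᵇ λ j → M i j ∧ (k ≡ᶠ i ∨ k ≡ᶠ j))

-- M ∈ 𝓜(A) for a p-subset A of [p+q]: M is a feasible matching (q arcs)
feasible : (p q : ℕ) → Subset (p + q) → ArcSet (p + q) → Bool
feasible p q A M =
  (arcCount M ≡ᵇ q) ∧ pairwiseDisjoint M ∧ oneEndIn A M ∧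
  disjointOrNested M ∧ covered M

Collection : ℕ → Set
Collection n = Subset n → Bool

Balanced : (p q : ℕ) → Collection (p + q) → Collection (p + q) → Set
Balanced p q 𝒜 𝒜' = (M : ArcSet (p + q)) → IsArcSet M →
  countSubsets (λ A → 𝒜 A ∧ feasible p q A M) ≡ countSubsets (λ A → 𝒜' A ∧ feasible p q A M)
  where open import Relation.Binary.PropositionalEquality using (_≡_)

𝒞 : (p q : ℕ) → Subset (p + q) → Collection (p + q)
𝒞 p q Q A = (size A ≡ᵇ p) ∧
  (∀ᵇ λ i → (suc (suc p) ≤ᵇ val i) ⇒ᵇ ((i ∈ᵇ A) ⇔ᵇ (i ∈ᵇ Q)))

isOdd : ℕ → Bool
isOdd m = m % 2 ≡ᵇ 1

𝒜odd : (p q : ℕ) → Subset (p + q) → Collection (p + q)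
𝒜odd p q Q A = 𝒞 p q Q A ∧ isOdd (Σ A)

𝒜even : (p q : ℕ) → Subset (p + q) → Collection (p + q)
𝒜even p q Q A = 𝒞 p q Q A ∧ not (isOdd (Σ A))

module Submission where

-- Fix an arc set M and call an arc (a, a+1) joining neighbours with a+1 ≤ p+1 a
-- short arc.  Two cases:
-- * M has a short arc (a, a+1).  Exchanging the memberships of a and a+1 is a
--   bijection on subsets.  Since distinct arcs of a feasible matching share no
--   endpoint, it preserves M ∈ 𝓜(A); for such A exactly one of a, a+1 lies in A,
--   so the exchange keeps |A|, moves Σ(A) by one and leaves [p+2..p+q] alone.
--   Hence it maps the even members A of 𝒞 with M ∈ 𝓜(A) onto the odd ones.
-- * M has no short arc.  Then M ∈ 𝓜(A) for no A: the q right endpoints are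
--   distinct, so by pigeonhole some arc ends in [1..p+1], and descending through
--   the arcs nested inside it (covered points are endpoints) ends at a short arc.

open import Defs
open import Data.Nat using (ℕ; suc; _+_; _≤_)
open import Data.Fin using (toℕ)
open import Data.Fin.Subset using (Subset)
open import Data.Bool using (T)

open import Data.Nat using (zero; _<_; _≟_; _∸_; _≡ᵇ_; _<ᵇ_; _≤ᵇ_; z≤n; s≤s⁻¹; z<s; s<s; _<?_; _≤?_)
open import Data.Nat.Properties
open import Data.Nat.ListAction using (sum)
open import Data.Nat.ListAction.Properties using (sum-++)
open import Algebra.Properties.CommutativeMonoid.Sum +-0-commutativeMonoid
  using (∑-comm; sum-cong-≗; sum-replicate-zero) renaming (sum to ∑)
open import Data.Fin using (Fin; fromℕ<) renaming (zero to fzero; suc to fsuc)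
import Data.Fin.Properties as Fin
open import Data.Fin.Properties using (toℕ-injective; toℕ-fromℕ<; toℕ<n; any?)
open import Data.Bool using (Bool; true; false; not; _∧_; _∨_; _xor_; if_then_else_)
open import Data.Bool.Properties using (T-≡; T-∧; ∧-zeroʳ; not-involutive)
open import Data.List using (List; _∷_; _++_; map; tabulate; allFin)
open import Data.Bool.ListAction using (and)
open import Data.List.Properties using (map-++; map-cong; map-∘; map-tabulate)
open import Data.List.Membership.Propositional using (lose)
open import Data.List.Membership.Propositional.Properties using (∈-allFin)
open import Data.List.Relation.Unary.All as All using ()
open import Data.List.Relation.Unary.All.Properties using (all⁺)
open import Data.List.Relation.Unary.Any using (satisfied)
open import Data.List.Relation.Unary.Any.Properties using (any⁺; any⁻)
open import Data.Vec using (_∷_; updateAt)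
open import Data.Vec.Properties using (lookup∘updateAt; lookup∘updateAt′; updateAt-commutes)
open import Data.Product using (∃; ∃₂; _×_; _,_)
open import Data.Sum using (_⊎_; inj₁; inj₂)
open import Function.Bundles using (Equivalence)
open import Relation.Nullary using (¬_; Dec; yes; no; contradiction)
open import Relation.Nullary.Decidable using (T?; _×-dec_)
open import Function using (_∘_)
open import Relation.Binary.PropositionalEquality

private
  variable
    n : ℕ

∀ᵇ-elim : {f : Fin n → Bool} → T (∀ᵇ f) → ∀ i → T (f i)
∀ᵇ-elim {n} {f} h i = All.lookup (all⁺ f (allFin n) h) (∈-allFin i)

∃ᵇ-intro : (f : Fin n → Bool) (i : Fin n) → T (f i) → T (∃ᵇ f)
∃ᵇ-intro f i fi = any⁺ f (lose (∈-allFin i) fi)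

∃ᵇ-elim : (f : Fin n → Bool) → T (∃ᵇ f) → ∃ λ i → T (f i)
∃ᵇ-elim {n} f h = satisfied (any⁻ f (allFin n) h)

∀ᵇ-cong : {f g : Fin n → Bool} → (∀ i → f i ≡ g i) → ∀ᵇ f ≡ ∀ᵇ g
∀ᵇ-cong {n} f≗g = cong and (map-cong f≗g (allFin n))

⇒ᵇ-elim : ∀ {x y} → T (x ⇒ᵇ y) → T x → T y
⇒ᵇ-elim {true} y _ = y

∧-elimˡ : ∀ {x y} → T (x ∧ y) → T x
∧-elimˡ {true} _ = _

∧-elimʳ : ∀ {x y} → T (x ∧ y) → T y
∧-elimʳ {true} h = h

∨-elim : ∀ x {y} → T (x ∨ y) → T x ⊎ T y
∨-elim true  _ = inj₁ _
∨-elim false h = inj₂ h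

twoArcs-elim : (M : ArcSet n) (P : Fin n → Fin n → Fin n → Fin n → Bool) →
  T (forallTwoArcs M P) → ∀ {i j i' j'} → T (M i j) → T (M i' j') → T (P i j i' j')
twoArcs-elim M P h {i} {j} {i'} {j'} m m' =
  ⇒ᵇ-elim (∀ᵇ-elim (∀ᵇ-elim (∀ᵇ-elim (∀ᵇ-elim h i) j) i') j') (Equivalence.from T-∧ (m , m'))

≡ᶠ-sound : {i j : Fin n} → T (i ≡ᶠ j) → i ≡ j
≡ᶠ-sound h = toℕ-injective (≡ᵇ⇒≡ _ _ h)

≡ᶠ-complete : {i j : Fin n} → ¬ T (i ≡ᶠ j) → i ≢ j
≡ᶠ-complete {i = i} h refl = h (≡⇒≡ᵇ (toℕ i) (toℕ i) refl)

T-from : ∀ {x} → x ≡ true → T x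
T-from = Equivalence.from T-≡

¬T-from : ∀ {x} → x ≡ false → ¬ T x
¬T-from refl ()

xor-not-not : ∀ x y → not x xor not y ≡ x xor y
xor-not-not true  y = refl
xor-not-not false y = not-involutive y

none-of-four : ∀ w x y z → T (not w ∧ not x ∧ not y ∧ not z) → ¬ T w × ¬ T x × ¬ T y × ¬ T z
none-of-four false false false false _ = (λ ()) , (λ ()) , (λ ()) , (λ ())
none-of-four true  _     _     _     ()
none-of-four false true  _     _     ()
none-of-four false false true  _     ()
none-of-four false false false true  ()

toggle : Fin n → Subset n → Subset n
toggle k A = updateAt A k not

∈-toggle : (k : Fin n) (A : Subset n) → (k ∈ᵇ toggle k A) ≡ not (k ∈ᵇ A)
∈-toggle k A = lookup∘updateAt k A

∈-toggle-other : {i k : Fin n} (A : Subset n) → i ≢ k → (i ∈ᵇ toggle k A) ≡ (i ∈ᵇ A)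
∈-toggle-other {i = i} {k} A i≢k = lookup∘updateAt′ i k i≢k A

countSubsets-suc : (P : Subset (suc n) → Bool) →
  countSubsets P ≡ countSubsets (λ A → P (true ∷ A)) + countSubsets (λ A → P (false ∷ A))
countSubsets-suc {n} P = begin
  sum (map indicator (map (true ∷_) S ++ map (false ∷_) S))
    ≡⟨ cong sum (map-++ indicator (map (true ∷_) S) (map (false ∷_) S)) ⟩
  sum (map indicator (map (true ∷_) S) ++ map indicator (map (false ∷_) S))
    ≡⟨ sum-++ (map indicator (map (true ∷_) S)) _ ⟩
  sum (map indicator (map (true ∷_) S)) + sum (map indicator (map (false ∷_) S))
    ≡⟨ cong₂ _+_ (cong sum (sym (map-∘ S))) (cong sum (sym (map-∘ S))) ⟩
  countSubsets (λ A → P (true ∷ A)) + countSubsets (λ A → P (false ∷ A)) ∎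
  where
  open ≡-Reasoning
  S : List (Subset n)
  S = allSubsets n
  indicator : Subset (suc n) → ℕ
  indicator A = if P A then 1 else 0

countSubsets-cong : {P P' : Subset n → Bool} → (∀ A → P A ≡ P' A) →
  countSubsets P ≡ countSubsets P'
countSubsets-cong {n} P≗P' =
  cong sum (map-cong (λ A → cong (λ b → if b then 1 else 0) (P≗P' A)) (allSubsets n))

-- Toggling an element is a bijection on subsets, so it does not change counts.
countSubsets-toggle : (k : Fin n) (P : Subset n → Bool) →
  countSubsets P ≡ countSubsets (λ A → P (toggle k A))
countSubsets-toggle {suc n} fzero P = begin
  countSubsets P
    ≡⟨ countSubsets-suc P ⟩
  countSubsets (λ A → P (true ∷ A)) + countSubsets (λ A → P (false ∷ A))
    ≡⟨ +-comm (countSubsets (λ A → P (true ∷ A))) _ ⟩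
  countSubsets (λ A → P (false ∷ A)) + countSubsets (λ A → P (true ∷ A))
    ≡⟨ countSubsets-suc (λ A → P (toggle fzero A)) ⟨
  countSubsets (λ A → P (toggle fzero A)) ∎
  where open ≡-Reasoning
countSubsets-toggle {suc n} (fsuc k) P = begin
  countSubsets P
    ≡⟨ countSubsets-suc P ⟩
  countSubsets (λ A → P (true ∷ A)) + countSubsets (λ A → P (false ∷ A))
    ≡⟨ cong₂ _+_ (countSubsets-toggle k (λ A → P (true ∷ A)))
                 (countSubsets-toggle k (λ A → P (false ∷ A))) ⟩
  countSubsets (λ A → P (true ∷ toggle k A)) + countSubsets (λ A → P (false ∷ toggle k A))
    ≡⟨ countSubsets-suc (λ A → P (toggle (fsuc k) A)) ⟨
  countSubsets (λ A → P (toggle (fsuc k) A)) ∎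
  where open ≡-Reasoning

weight : (Fin n → ℕ) → Subset n → ℕ
weight g A = ∑ (λ i → if i ∈ᵇ A then g i else 0)

sum-allFin : (f : Fin n → ℕ) → sum (map f (allFin n)) ≡ ∑ f
sum-allFin {n} f = trans (cong sum (map-tabulate (λ i → i) f)) (sum-tabulate n f)
  where
  sum-tabulate : ∀ n (f : Fin n → ℕ) → sum (tabulate f) ≡ ∑ f
  sum-tabulate zero    f = refl
  sum-tabulate (suc n) f = cong (f fzero +_) (sum-tabulate n (λ i → f (fsuc i)))

size-weight : (A : Subset n) → size A ≡ weight (λ _ → 1) A
size-weight A = sum-allFin (λ i → if i ∈ᵇ A then 1 else 0)

Σ-weight : (A : Subset n) → Σ A ≡ weight val A
Σ-weight A = sum-allFin (λ i → if i ∈ᵇ A then val i else 0)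

weight-remove : (g : Fin n → ℕ) (k : Fin n) (A : Subset n) → T (k ∈ᵇ A) →
  weight g (toggle k A) + g k ≡ weight g A
weight-remove g fzero    (true  ∷ A) _ = +-comm (weight (λ i → g (fsuc i)) A) (g fzero)
weight-remove g (fsuc k) (x     ∷ A) k∈A = begin
  (if x then g fzero else 0) + weight (λ i → g (fsuc i)) (toggle k A) + g (fsuc k)
    ≡⟨ +-assoc (if x then g fzero else 0) _ _ ⟩
  (if x then g fzero else 0) + (weight (λ i → g (fsuc i)) (toggle k A) + g (fsuc k))
    ≡⟨ cong ((if x then g fzero else 0) +_) (weight-remove (λ i → g (fsuc i)) k A k∈A) ⟩
  (if x then g fzero else 0) + weight (λ i → g (fsuc i)) A ∎
  where open ≡-Reasoning

weight-add : (g : Fin n → ℕ) (k : Fin n) (A : Subset n) → ¬ T (k ∈ᵇ A) →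
  weight g (toggle k A) ≡ weight g A + g k
weight-add g fzero    (true  ∷ A) k∉A = contradiction _ k∉A
weight-add g fzero    (false ∷ A) _   = +-comm (g fzero) (weight (λ i → g (fsuc i)) A)
weight-add g (fsuc k) (x     ∷ A) k∉A = begin
  (if x then g fzero else 0) + weight (λ i → g (fsuc i)) (toggle k A)
    ≡⟨ cong ((if x then g fzero else 0) +_) (weight-add (λ i → g (fsuc i)) k A k∉A) ⟩
  (if x then g fzero else 0) + (weight (λ i → g (fsuc i)) A + g (fsuc k))
    ≡⟨ +-assoc (if x then g fzero else 0) _ _ ⟨
  (if x then g fzero else 0) + weight (λ i → g (fsuc i)) A + g (fsuc k) ∎
  where open ≡-Reasoning

weight-exchange : (g : Fin n → ℕ) {a b : Fin n} (A : Subset n) →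
  T (a ∈ᵇ A) → ¬ T (b ∈ᵇ A) → weight g (toggle b (toggle a A)) + g a ≡ weight g A + g b
weight-exchange {n} g {a} {b} A a∈A b∉A = begin
  weight g (toggle b A₁) + g a ≡⟨ cong (_+ g a) (weight-add g b A₁ b∉A₁) ⟩
  weight g A₁ + g b + g a      ≡⟨ +-assoc (weight g A₁) (g b) (g a) ⟩
  weight g A₁ + (g b + g a)    ≡⟨ cong (weight g A₁ +_) (+-comm (g b) (g a)) ⟩
  weight g A₁ + (g a + g b)    ≡⟨ +-assoc (weight g A₁) (g a) (g b) ⟨
  weight g A₁ + g a + g b      ≡⟨ cong (_+ g b) (weight-remove g a A a∈A) ⟩
  weight g A + g b             ∎
  where
  open ≡-Reasoning
  A₁ : Subset n
  A₁ = toggle a A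
  b≢a : b ≢ a
  b≢a refl = b∉A a∈A
  b∉A₁ : ¬ T (b ∈ᵇ A₁)
  b∉A₁ = subst (λ x → ¬ T x) (sym (∈-toggle-other A b≢a)) b∉A

size-exchange : {a b : Fin n} (A : Subset n) → T (a ∈ᵇ A) → ¬ T (b ∈ᵇ A) →
  size (toggle b (toggle a A)) ≡ size A
size-exchange {n} {a} {b} A a∈A b∉A = begin
  size A'                  ≡⟨ size-weight A' ⟩
  weight (λ _ → 1) A'      ≡⟨ +-cancelʳ-≡ 1 _ _ (weight-exchange (λ _ → 1) A a∈A b∉A) ⟩
  weight (λ _ → 1) A       ≡⟨ size-weight A ⟨
  size A                   ∎
  where
  open ≡-Reasoning
  A' : Subset n
  A' = toggle b (toggle a A)

Σ-exchange : {a b : Fin n} (A : Subset n) → T (a ∈ᵇ A) → ¬ T (b ∈ᵇ A) →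
  Σ (toggle b (toggle a A)) + val a ≡ Σ A + val b
Σ-exchange {n} {a} {b} A a∈A b∉A = begin
  Σ A' + val a             ≡⟨ cong (_+ val a) (Σ-weight A') ⟩
  weight val A' + val a    ≡⟨ weight-exchange val A a∈A b∉A ⟩
  weight val A + val b     ≡⟨ cong (_+ val b) (Σ-weight A) ⟨
  Σ A + val b              ∎
  where
  open ≡-Reasoning
  A' : Subset n
  A' = toggle b (toggle a A)

-- Parity of a successor ((2 + m) % 2 and m % 2 agree by computation).
isOdd-suc : ∀ m → isOdd (suc m) ≡ not (isOdd m)
isOdd-suc zero          = refl
isOdd-suc (suc zero)    = refl
isOdd-suc (suc (suc m)) = isOdd-suc m

data SameOrDisjoint {n} (i j i' j' : Fin n) : Set where
  same     : i ≡ i' → j ≡ j' → SameOrDisjoint i j i' j'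
  disjoint : i ≢ i' → i ≢ j' → j ≢ i' → j ≢ j' → SameOrDisjoint i j i' j'

separated : Fin n → Fin n → Fin n → Fin n → Bool
separated i j i' j' = (i ≡ᶠ i' ∧ j ≡ᶠ j') ∨
  (not (i ≡ᶠ i') ∧ not (i ≡ᶠ j') ∧ not (j ≡ᶠ i') ∧ not (j ≡ᶠ j'))

sameOrDisjoint : {M : ArcSet n} → T (pairwiseDisjoint M) →
  ∀ {i j i' j'} → T (M i j) → T (M i' j') → SameOrDisjoint i j i' j'
sameOrDisjoint {M = M} pd {i} {j} {i'} {j'} m m'
  with ∨-elim ((i ≡ᶠ i') ∧ (j ≡ᶠ j')) (twoArcs-elim M separated pd m m')
... | inj₁ h = same (≡ᶠ-sound (∧-elimˡ h)) (≡ᶠ-sound (∧-elimʳ h))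
... | inj₂ h with none-of-four (i ≡ᶠ i') (i ≡ᶠ j') (j ≡ᶠ i') (j ≡ᶠ j') h
...   | ii' , ij' , ji' , jj' =
  disjoint (≡ᶠ-complete ii') (≡ᶠ-complete ij') (≡ᶠ-complete ji') (≡ᶠ-complete jj')

data DisjointOrNested (i j i' j' : ℕ) : Set where
  before   : j < i'          → DisjointOrNested i j i' j'
  after    : j' < i          → DisjointOrNested i j i' j'
  contains : i ≤ i' → j' ≤ j → DisjointOrNested i j i' j'
  inside   : i' ≤ i → j ≤ j' → DisjointOrNested i j i' j'

laminarPair : Fin n → Fin n → Fin n → Fin n → Bool
laminarPair i j i' j' = (toℕ j <ᵇ toℕ i') ∨ (toℕ j' <ᵇ toℕ i) ∨
  ((toℕ i ≤ᵇ toℕ i') ∧ (toℕ j' ≤ᵇ toℕ j)) ∨ ((toℕ i' ≤ᵇ toℕ i) ∧ (toℕ j ≤ᵇ toℕ j'))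

disjointOrNested-elim : {M : ArcSet n} → T (disjointOrNested M) →
  ∀ {i j i' j'} → T (M i j) → T (M i' j') → DisjointOrNested (toℕ i) (toℕ j) (toℕ i') (toℕ j')
disjointOrNested-elim {M = M} dn {i} {j} {i'} {j'} m m'
  with ∨-elim (toℕ j <ᵇ toℕ i') (twoArcs-elim M laminarPair dn m m')
... | inj₁ h = before (<ᵇ⇒< (toℕ j) (toℕ i') h)
... | inj₂ h with ∨-elim (toℕ j' <ᵇ toℕ i) h
...   | inj₁ h' = after (<ᵇ⇒< (toℕ j') (toℕ i) h')
...   | inj₂ h' with ∨-elim ((toℕ i ≤ᵇ toℕ i') ∧ (toℕ j' ≤ᵇ toℕ j)) h'
...     | inj₁ h'' = contains (≤ᵇ⇒≤ (toℕ i) (toℕ i') (∧-elimˡ h'')) (≤ᵇ⇒≤ (toℕ j') (toℕ j) (∧-elimʳ h''))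
...     | inj₂ h'' = inside (≤ᵇ⇒≤ (toℕ i') (toℕ i) (∧-elimˡ h'')) (≤ᵇ⇒≤ (toℕ j) (toℕ j') (∧-elimʳ h''))

covered-elim : {M : ArcSet n} → T (covered M) →
  ∀ {i j} k → T (M i j) → toℕ i ≤ toℕ k → toℕ k ≤ toℕ j →
  ∃₂ λ x y → T (M x y) × (k ≡ x ⊎ k ≡ y)
covered-elim {M = M} cv {i} {j} k m i≤k k≤j
  with ∃ᵇ-elim _ (⇒ᵇ-elim (∀ᵇ-elim cv k) inInterval)
  where
  inInterval : T (∃ᵇ λ x → ∃ᵇ λ y → M x y ∧ (toℕ x ≤ᵇ toℕ k) ∧ (toℕ k ≤ᵇ toℕ y))
  inInterval = ∃ᵇ-intro _ i (∃ᵇ-intro _ j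
    (Equivalence.from T-∧ (m , Equivalence.from T-∧ (≤⇒≤ᵇ i≤k , ≤⇒≤ᵇ k≤j))))
... | x , h with ∃ᵇ-elim _ h
...   | y , h' with ∨-elim (k ≡ᶠ x) (∧-elimʳ {M x y} h')
...     | inj₁ k≡x = x , y , ∧-elimˡ h' , inj₁ (≡ᶠ-sound k≡x)
...     | inj₂ k≡y = x , y , ∧-elimˡ h' , inj₂ (≡ᶠ-sound k≡y)

record FeasibleMatching (p q : ℕ) (A : Subset (p + q)) (M : ArcSet (p + q)) : Set where
  field
    count    : arcCount M ≡ q
    separate : ∀ {i j i' j'} → T (M i j) → T (M i' j') → SameOrDisjoint i j i' j'
    oneEnd   : ∀ {i j} → T (M i j) → T ((i ∈ᵇ A) xor (j ∈ᵇ A))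
    laminar  : ∀ {i j i' j'} → T (M i j) → T (M i' j') →
               DisjointOrNested (toℕ i) (toℕ j) (toℕ i') (toℕ j')
    covering : ∀ {i j} k → T (M i j) → toℕ i ≤ toℕ k → toℕ k ≤ toℕ j →
               ∃₂ λ x y → T (M x y) × (k ≡ x ⊎ k ≡ y)

feasible-elim : ∀ {p q A M} → T (feasible p q A M) → FeasibleMatching p q A M
feasible-elim {q = q} {A} {M} h = record
  { count    = ≡ᵇ⇒≡ (arcCount M) q (∧-elimˡ h)
  ; separate = sameOrDisjoint (∧-elimˡ h₁)
  ; oneEnd   = λ {i} {j} m → ⇒ᵇ-elim (∀ᵇ-elim (∀ᵇ-elim (∧-elimˡ h₂) i) j) m
  ; laminar  = disjointOrNested-elim (∧-elimˡ h₃)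
  ; covering = covered-elim (∧-elimʳ h₃)
  }
  where
  h₁ : T (pairwiseDisjoint M ∧ oneEndIn A M ∧ disjointOrNested M ∧ covered M)
  h₁ = ∧-elimʳ {arcCount M ≡ᵇ q} h
  h₂ : T (oneEndIn A M ∧ disjointOrNested M ∧ covered M)
  h₂ = ∧-elimʳ {pairwiseDisjoint M} h₁
  h₃ : T (disjointOrNested M ∧ covered M)
  h₃ = ∧-elimʳ {oneEndIn A M} h₂

arcCount-byRightEnd : (M : ArcSet n) → arcCount M ≡ ∑ (λ j → ∑ (λ i → if M i j then 1 else 0))
arcCount-byRightEnd {n} M = begin
  arcCount M
    ≡⟨ cong sum (map-cong (λ i → sum-allFin (λ j → if M i j then 1 else 0)) (allFin n)) ⟩
  sum (map (λ i → ∑ (λ j → if M i j then 1 else 0)) (allFin n))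
    ≡⟨ sum-allFin (λ i → ∑ (λ j → if M i j then 1 else 0)) ⟩
  ∑ (λ i → ∑ (λ j → if M i j then 1 else 0))
    ≡⟨ ∑-comm (λ i j → if M i j then 1 else 0) ⟩
  ∑ (λ j → ∑ (λ i → if M i j then 1 else 0)) ∎
  where open ≡-Reasoning

∑-atMostOne : (f : Fin n → Bool) → (∀ {i i'} → T (f i) → T (f i') → i ≡ i') →
  ∑ (λ i → if f i then 1 else 0) ≤ 1
∑-atMostOne {zero}  f unique = z≤n
∑-atMostOne {suc n} f unique with f fzero in f0
... | true  = ≤-reflexive (cong suc (trans (sum-cong-≗ no-other) (sum-replicate-zero n)))
  where
  no-other : ∀ i → (if f (fsuc i) then 1 else 0) ≡ 0
  no-other i with f (fsuc i) in fi
  ... | false = refl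
  ... | true  with unique (T-from f0) (T-from fi)
  ...   | ()
... | false = ∑-atMostOne (f ∘ fsuc) (λ fi fi' → Fin.suc-injective (unique fi fi'))

∑-bound : ∀ m (c : Fin n → ℕ) → (∀ j → c j ≤ 1) → (∀ j → toℕ j < m → c j ≡ 0) → ∑ c ≤ n ∸ m
∑-bound {zero}  m       c _ _ = z≤n
∑-bound {suc n} zero    c c≤1 _ =
  +-mono-≤ (c≤1 fzero) (∑-bound 0 (c ∘ fsuc) (c≤1 ∘ fsuc) (λ _ ()))
∑-bound {suc n} (suc m) c c≤1 c≡0 =
  subst (λ c0 → c0 + ∑ (c ∘ fsuc) ≤ n ∸ m) (sym (c≡0 fzero z<s))
    (∑-bound m (c ∘ fsuc) (c≤1 ∘ fsuc) (λ j j<m → c≡0 (fsuc j) (s<s j<m)))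

early-arc : ∀ m (M : ArcSet n) → (∀ {i i' j} → T (M i j) → T (M i' j) → i ≡ i') →
  n ∸ m < arcCount M → ∃₂ λ i j → T (M i j) × toℕ j < m
early-arc {n} m M unique many
  with any? (λ i → any? (λ j → T? (M i j) ×-dec (toℕ j <? m)))
... | yes (i , j , mij , j<m) = i , j , mij , j<m
... | no  none = contradiction (subst (_≤ n ∸ m) (sym (arcCount-byRightEnd M)) few) (<⇒≱ many)
  where
  column : Fin n → ℕ
  column j = ∑ (λ i → if M i j then 1 else 0)
  empty-column : ∀ j → toℕ j < m → column j ≡ 0
  empty-column j j<m = trans (sum-cong-≗ no-arc) (sum-replicate-zero n)
    where
    no-arc : ∀ i → (if M i j then 1 else 0) ≡ 0
    no-arc i with M i j in mij
    ... | false = refl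
    ... | true  = contradiction (i , j , T-from mij , j<m) none
  few : ∑ column ≤ n ∸ m
  few = ∑-bound m column (λ j → ∑-atMostOne (λ i → M i j) unique) empty-column

-- Right endpoints beyond position p+1 fit at most q - 1 arcs.
room : ∀ p q → 1 ≤ q → (p + q) ∸ suc p < q
room zero    (suc q) _   = ≤-refl
room (suc p) q       1≤q = room p q 1≤q

ShortArc : ℕ → ArcSet n → Set
ShortArc b M = ∃₂ λ a a' → T (M a a') × toℕ a' ≡ suc (toℕ a) × toℕ a' ≤ b

module _ {p q A M} (isArcSet : IsArcSet M) (F : FeasibleMatching p q A M) where
  open FeasibleMatching F

  -- If an arc (i,j) is not short, the point i+1 is covered: either by a short arc
  -- ending at most at j, or as the left end of an arc nested inside (i,j).
  arc-after : ∀ {i j} → T (M i j) → suc (toℕ i) < toℕ j →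
    ShortArc (toℕ j) M ⊎ ∃₂ λ x y → T (M x y) × toℕ x ≡ suc (toℕ i) × toℕ y ≤ toℕ j
  arc-after {i} {j} m 1+i<j with covering k m i≤k k≤j
    where
    k : Fin (p + q)
    k = fromℕ< (<-trans 1+i<j (toℕ<n j))
    i≤k : toℕ i ≤ toℕ k
    i≤k = subst (toℕ i ≤_) (sym (toℕ-fromℕ< _)) (n≤1+n _)
    k≤j : toℕ k ≤ toℕ j
    k≤j = subst (_≤ toℕ j) (sym (toℕ-fromℕ< _)) (<⇒≤ 1+i<j)
  ... | x , y , mxy , inj₁ refl = inj₂ (x , y , mxy , x≡1+i , leftEnd (laminar m mxy))
    where
    x≡1+i : toℕ x ≡ suc (toℕ i)
    x≡1+i = toℕ-fromℕ< _
    leftEnd : DisjointOrNested (toℕ i) (toℕ j) (toℕ x) (toℕ y) → toℕ y ≤ toℕ j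
    leftEnd (before j<x)   = contradiction (subst (_< toℕ j) (sym x≡1+i) 1+i<j) (<-asym j<x)
    leftEnd (after y<i)    =
      contradiction (<-trans (subst (toℕ i <_) (sym x≡1+i) ≤-refl) (isArcSet x y mxy)) (<-asym y<i)
    leftEnd (contains _ y≤j) = y≤j
    leftEnd (inside x≤i _) = contradiction (subst (_≤ toℕ i) x≡1+i x≤i) 1+n≰n
  ... | x , y , mxy , inj₂ refl = inj₁ (rightEnd (laminar m mxy))
    where
    y≡1+i : toℕ y ≡ suc (toℕ i)
    y≡1+i = toℕ-fromℕ< _
    x≤i : toℕ x ≤ toℕ i
    x≤i = s≤s⁻¹ (subst (toℕ x <_) y≡1+i (isArcSet x y mxy))
    rightEnd : DisjointOrNested (toℕ i) (toℕ j) (toℕ x) (toℕ y) → ShortArc (toℕ j) M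
    rightEnd (before j<x)        = contradiction (≤-trans x≤i (<⇒≤ (isArcSet i j m))) (<⇒≱ j<x)
    rightEnd (after y<i)         = contradiction (subst (_< toℕ i) y≡1+i y<i) (<-asym (n<1+n _))
    rightEnd (contains i≤x y≤j)  =
      x , y , mxy , trans y≡1+i (cong suc (≤-antisym i≤x x≤i)) , y≤j
    rightEnd (inside _ j≤y)      = contradiction (subst (toℕ j ≤_) y≡1+i j≤y) (<⇒≱ 1+i<j)

  -- Descending through nested arcs: every arc of length at most d that ends at most
  -- at b contains a short arc below b.
  short-arc-inside : ∀ d b {i j} → T (M i j) → toℕ j ≤ toℕ i + d → toℕ j ≤ b → ShortArc b M
  short-arc-inside zero b {i} {j} m j≤i+0 _ =
    contradiction (subst (toℕ j ≤_) (+-identityʳ (toℕ i)) j≤i+0) (<⇒≱ (isArcSet i j m))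
  short-arc-inside (suc d) b {i} {j} m j≤i+d j≤b with toℕ j ≟ suc (toℕ i)
  ... | yes j≡1+i = i , j , m , j≡1+i , j≤b
  ... | no  j≢1+i with arc-after m (≤∧≢⇒< (isArcSet i j m) (j≢1+i ∘ sym))
  ...   | inj₁ (a , a' , maa' , a'≡1+a , a'≤j) = a , a' , maa' , a'≡1+a , ≤-trans a'≤j j≤b
  ...   | inj₂ (x , y , mxy , x≡1+i , y≤j) = short-arc-inside d b mxy y≤x+d (≤-trans y≤j j≤b)
    where
    y≤x+d : toℕ y ≤ toℕ x + d
    y≤x+d = ≤-trans y≤j (≤-trans j≤i+d
              (≤-reflexive (trans (+-suc (toℕ i) d) (cong (_+ d) (sym x≡1+i)))))

  -- Every feasible matching with at least one arc has a short arc below p: by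
  -- pigeonhole some arc ends in [1..p+1], and that arc contains a short arc.
  short-arc : 1 ≤ q → ShortArc p M
  short-arc 1≤q with early-arc (suc p) M unique-left more-than-room
    where
    unique-left : ∀ {i i' j} → T (M i j) → T (M i' j) → i ≡ i'
    unique-left m m' with separate m m'
    ... | same i≡i' _          = i≡i'
    ... | disjoint _ _ _ j≢j = contradiction refl j≢j
    more-than-room : (p + q) ∸ suc p < arcCount M
    more-than-room = subst ((p + q) ∸ suc p <_) (sym count) (room p q 1≤q)
  ... | i , j , mij , j<1+p = short-arc-inside (toℕ j) p mij (m≤n+m (toℕ j) (toℕ i)) (s≤s⁻¹ j<1+p)

shortArc? : ∀ b (M : ArcSet n) → Dec (ShortArc b M)
shortArc? b M = any? λ a → any? λ a' → T? (M a a') ×-dec ((toℕ a' ≟ suc (toℕ a)) ×-dec (toℕ a' ≤? b))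

infeasible-without-short-arc : ∀ {p q} {M : ArcSet (p + q)} → IsArcSet M → 1 ≤ q →
  ¬ ShortArc p M → ∀ A → feasible p q A M ≡ false
infeasible-without-short-arc {p} {q} {M} isArcSet 1≤q none A with feasible p q A M in feas
... | false = refl
... | true  = contradiction (short-arc isArcSet (feasible-elim {A = A} (T-from feas)) 1≤q) none

balanced-at-infeasible : ∀ {p q} (𝒜 𝒜' : Collection (p + q)) (M : ArcSet (p + q)) →
  (∀ A → feasible p q A M ≡ false) →
  countSubsets (λ A → 𝒜 A ∧ feasible p q A M) ≡ countSubsets (λ A → 𝒜' A ∧ feasible p q A M)
balanced-at-infeasible {p} {q} 𝒜 𝒜' M infeasible = countSubsets-cong λ A → begin
  𝒜 A ∧ feasible p q A M  ≡⟨ cong (𝒜 A ∧_) (infeasible A) ⟩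
  𝒜 A ∧ false             ≡⟨ ∧-zeroʳ (𝒜 A) ⟩
  false                   ≡⟨ ∧-zeroʳ (𝒜' A) ⟨
  𝒜' A ∧ false            ≡⟨ cong (𝒜' A ∧_) (infeasible A) ⟨
  𝒜' A ∧ feasible p q A M ∎
  where open ≡-Reasoning

module Exchange (p q : ℕ) (Q : Subset (p + q)) (M : ArcSet (p + q)) {a b : Fin (p + q)}
  (mab : T (M a b)) (b≡1+a : toℕ b ≡ suc (toℕ a)) (b≤p : toℕ b ≤ p) where

  flip : Subset (p + q) → Subset (p + q)
  flip A = toggle b (toggle a A)

  a≢b : a ≢ b
  a≢b a≡b = 1+n≰n (≤-reflexive (trans (sym b≡1+a) (cong toℕ (sym a≡b))))

  b≢a : b ≢ a
  b≢a = a≢b ∘ sym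

  ∈-flip-a : ∀ A → (a ∈ᵇ flip A) ≡ not (a ∈ᵇ A)
  ∈-flip-a A = trans (∈-toggle-other (toggle a A) a≢b) (∈-toggle a A)

  ∈-flip-b : ∀ A → (b ∈ᵇ flip A) ≡ not (b ∈ᵇ A)
  ∈-flip-b A = trans (∈-toggle b (toggle a A)) (cong not (∈-toggle-other A b≢a))

  ∈-flip-other : ∀ A {i} → i ≢ a → i ≢ b → (i ∈ᵇ flip A) ≡ (i ∈ᵇ A)
  ∈-flip-other A i≢a i≢b = trans (∈-toggle-other (toggle a A) i≢b) (∈-toggle-other A i≢a)

  -- The arc (a,b) keeps exactly one end in flip A, and the other arcs avoid a and b.
  oneEndIn-flip : T (pairwiseDisjoint M) → ∀ A → oneEndIn (flip A) M ≡ oneEndIn A M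
  oneEndIn-flip pd A = ∀ᵇ-cong λ i → ∀ᵇ-cong λ j → arc i j
    where
    arc : ∀ i j → (M i j ⇒ᵇ ((i ∈ᵇ flip A) xor (j ∈ᵇ flip A))) ≡ (M i j ⇒ᵇ ((i ∈ᵇ A) xor (j ∈ᵇ A)))
    arc i j with M i j in mij
    ... | false = refl
    ... | true with sameOrDisjoint {M = M} pd {i} {j} {a} {b} (T-from mij) mab
    ...   | same refl refl = trans (cong₂ _xor_ (∈-flip-a A) (∈-flip-b A)) (xor-not-not (i ∈ᵇ A) (j ∈ᵇ A))
    ...   | disjoint i≢a i≢b j≢a j≢b = cong₂ _xor_ (∈-flip-other A i≢a i≢b) (∈-flip-other A j≢a j≢b)

  feasible-flip : ∀ A → feasible p q (flip A) M ≡ feasible p q A M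
  feasible-flip A with pairwiseDisjoint M in pd
  ... | false = refl
  ... | true  = cong (λ oe → (arcCount M ≡ᵇ q) ∧ true ∧ oe ∧ disjointOrNested M ∧ covered M)
                     (oneEndIn-flip (T-from pd) A)

  -- a and b lie below p+2, where 𝒞 does not prescribe membership.
  𝒞-flip : ∀ A → size (flip A) ≡ size A → 𝒞 p q Q (flip A) ≡ 𝒞 p q Q A
  𝒞-flip A size≡ = cong₂ _∧_ (cong (_≡ᵇ p) size≡) (∀ᵇ-cong prescribed)
    where
    prescribed : ∀ i → ((suc (suc p) ≤ᵇ val i) ⇒ᵇ ((i ∈ᵇ flip A) ⇔ᵇ (i ∈ᵇ Q)))
                     ≡ ((suc (suc p) ≤ᵇ val i) ⇒ᵇ ((i ∈ᵇ A) ⇔ᵇ (i ∈ᵇ Q)))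
    prescribed i with suc (suc p) ≤ᵇ val i in high
    ... | false = refl
    ... | true  = cong (_⇔ᵇ (i ∈ᵇ Q)) (∈-flip-other A i≢a i≢b)
      where
      p<i : p < toℕ i
      p<i = s≤s⁻¹ (≤ᵇ⇒≤ (suc (suc p)) (val i) (T-from high))
      i≢b : i ≢ b
      i≢b refl = <⇒≱ p<i b≤p
      i≢a : i ≢ a
      i≢a refl = <⇒≱ p<i (≤-trans (n≤1+n (toℕ a)) (subst (_≤ p) b≡1+a b≤p))

  -- If exactly one of a, b lies in A, flipping keeps |A| and moves Σ(A) by one:
  -- up when a ∈ A, down when b ∈ A (then flip A exchanges b for a).
  flip-effect : ∀ A → T ((a ∈ᵇ A) xor (b ∈ᵇ A)) →
    size (flip A) ≡ size A × isOdd (Σ (flip A)) ≡ not (isOdd (Σ A))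
  flip-effect A one with a ∈ᵇ A in ea | b ∈ᵇ A in eb
  flip-effect A ()  | true  | true
  flip-effect A ()  | false | false
  ... | true  | false = size-exchange A (T-from ea) (¬T-from eb) , (begin
    isOdd (Σ (flip A))     ≡⟨ cong isOdd Σ-up ⟩
    isOdd (suc (Σ A))      ≡⟨ isOdd-suc (Σ A) ⟩
    not (isOdd (Σ A))      ∎)
    where
    open ≡-Reasoning
    Σ-up : Σ (flip A) ≡ suc (Σ A)
    Σ-up = +-cancelʳ-≡ (val a) _ _ (begin
      Σ (flip A) + val a        ≡⟨ Σ-exchange A (T-from ea) (¬T-from eb) ⟩
      Σ A + val b               ≡⟨ cong (λ x → Σ A + suc x) b≡1+a ⟩
      Σ A + suc (val a)         ≡⟨ +-suc (Σ A) (val a) ⟩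
      suc (Σ A) + val a         ∎)
  ... | false | true  = trans (cong size flip≡) (size-exchange A (T-from eb) (¬T-from ea)) , (begin
    isOdd (Σ (flip A))             ≡⟨ not-involutive (isOdd (Σ (flip A))) ⟨
    not (not (isOdd (Σ (flip A)))) ≡⟨ cong not (isOdd-suc (Σ (flip A))) ⟨
    not (isOdd (suc (Σ (flip A)))) ≡⟨ cong (not ∘ isOdd) Σ-down ⟩
    not (isOdd (Σ A))              ∎)
    where
    open ≡-Reasoning
    flip≡ : flip A ≡ toggle a (toggle b A)
    flip≡ = updateAt-commutes b a b≢a A
    Σ-down : suc (Σ (flip A)) ≡ Σ A
    Σ-down = +-cancelʳ-≡ (val a) _ _ (begin
      suc (Σ (flip A)) + val a  ≡⟨ +-suc (Σ (flip A)) (val a) ⟨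
      Σ (flip A) + suc (val a)  ≡⟨ cong (λ x → Σ (flip A) + suc x) b≡1+a ⟨
      Σ (flip A) + val b        ≡⟨ cong (λ B → Σ B + val b) flip≡ ⟩
      Σ (toggle a (toggle b A)) + val b ≡⟨ Σ-exchange A (T-from eb) (¬T-from ea) ⟩
      Σ A + val a               ∎)

  even↦odd : ∀ A → (𝒜even p q Q A ∧ feasible p q A M) ≡ (𝒜odd p q Q (flip A) ∧ feasible p q (flip A) M)
  even↦odd A rewrite feasible-flip A with feasible p q A M in feas
  ... | false = trans (∧-zeroʳ _) (sym (∧-zeroʳ _))
  ... | true  with flip-effect A (FeasibleMatching.oneEnd (feasible-elim {p} {q} {A} {M} (T-from feas)) mab)
  ...   | size≡ , parity = cong (_∧ true) (cong₂ _∧_ (sym (𝒞-flip A size≡)) (sym parity))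

  -- flip is a composite of two toggles, hence a bijection on subsets.
  balanced : countSubsets (λ A → 𝒜odd p q Q A ∧ feasible p q A M)
           ≡ countSubsets (λ A → 𝒜even p q Q A ∧ feasible p q A M)
  balanced = begin
    countSubsets oddFeasible                      ≡⟨ countSubsets-toggle b oddFeasible ⟩
    countSubsets (λ A → oddFeasible (toggle b A)) ≡⟨ countSubsets-toggle a (λ A → oddFeasible (toggle b A)) ⟩
    countSubsets (λ A → oddFeasible (flip A))     ≡⟨ countSubsets-cong (λ A → sym (even↦odd A)) ⟩
    countSubsets (λ A → 𝒜even p q Q A ∧ feasible p q A M) ∎
    where
    open ≡-Reasoning
    oddFeasible : Subset (p + q) → Bool
    oddFeasible A = 𝒜odd p q Q A ∧ feasible p q A M

lemma5 : (p q : ℕ) → q ≤ p → 1 ≤ q → (Q : Subset (p + q)) →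
    (∀ i → T (i ∈ᵇ Q) → suc (suc p) ≤ val i) →
    Balanced p q (𝒜odd p q Q) (𝒜even p q Q)
lemma5 p q _ 1≤q Q _ M isArcSet with shortArc? p M
... | yes (a , b , mab , b≡1+a , b≤p) = Exchange.balanced p q Q M mab b≡1+a b≤p
... | no  none = balanced-at-infeasible {p} {q} (𝒜odd p q Q) (𝒜even p q Q) M
                   (infeasible-without-short-arc {p} {q} isArcSet 1≤q none)
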